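{- Let $G$ be a connected graph with minimum degree $\delta(G)\ge 2$. If $G$ contains a connected factor $F$ with $\deg_F(v)<\deg_G(v)$ for every vertex $v$ of $G$, then $G$ has the strong parity property.
   Context: Graphs may have loops and multiple edges; the degree $\deg_G(v)$ counts each loop twice. A factor of $G$ is a spanning subgraph $H$ of $G$ with minimum degree $\delta(H)\ge 1$. For a set $X\subseteq V(G)$ of even cardinality, an $X$-parity-factor of $G$ is a factor $H$ of $G$ such that $\deg_H(v)$ is odd for every $v\in X$ and $\deg_H(v)$ is even for every $v\in V(G)\setminus X$. A graph $G$ has the strong parity property if for every subset $X\subseteq V(G)$ of even cardinality (including $X=\emptyset$), $G$ has an $X$-parity-factor. -}

module Defs where

open import Data.Nat using (ℕ; zero; suc; _+_; _≤_; _<_)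
open import Data.Nat.Divisibility using (_∣_)
open import Data.Bool using (Bool; true; false; if_then_else_)
open import Data.Fin using (Fin; zero; suc; _≟_)
open import Data.Fin.Subset using (Subset; _∈_; _∉_; ∣_∣)
open import Data.Product using (_×_; _,_; proj₁; proj₂; ∃)
open import Data.Sum using (_⊎_)
open import Relation.Nullary using (¬_; does)
open import Relation.Binary.PropositionalEquality using (_≡_)

sumFin : {m : ℕ} → (Fin m → ℕ) → ℕ
sumFin {zero}  f = 0
sumFin {suc m} f = f zero + sumFin (λ i → f (suc i))

-- A finite multigraph (loops and parallel edges allowed):
-- vertices Fin nV, edges Fin nE, each edge has an (unordered) pair of ends.
record Graph : Set where
  field
    nV   : ℕ
    nE   : ℕ
    ends : Fin nE → Fin nV × Fin nV

open Graph public

-- A spanning subgraph is given by the set of its edges.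
SpanningSubgraph : Graph → Set
SpanningSubgraph G = Fin (nE G) → Bool

allEdges : (G : Graph) → SpanningSubgraph G
allEdges G e = true

-- number of ends of edge e at vertex v (a loop at v contributes 2)
incidence : (G : Graph) → Fin (nE G) → Fin (nV G) → ℕ
incidence G e v =
  (if does (proj₁ (ends G e) ≟ v) then 1 else 0) +
  (if does (proj₂ (ends G e) ≟ v) then 1 else 0)

deg : (G : Graph) → SpanningSubgraph G → Fin (nV G) → ℕ
deg G H v = sumFin (λ e → if H e then incidence G e v else 0)

degG : (G : Graph) → Fin (nV G) → ℕ
degG G = deg G (allEdges G)

data Walk (G : Graph) (H : SpanningSubgraph G) : Fin (nV G) → Fin (nV G) → Set where
  here : ∀ {u} → Walk G H u u
  step : ∀ {u w v} (e : Fin (nE G)) → H e ≡ true →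
         (ends G e ≡ (u , w) ⊎ ends G e ≡ (w , u)) →
         Walk G H w v → Walk G H u v

Connected : (G : Graph) → SpanningSubgraph G → Set
Connected G H = ∀ u v → Walk G H u v

ConnectedGraph : Graph → Set
ConnectedGraph G = Connected G (allEdges G)

MinDegree≥ : (G : Graph) → SpanningSubgraph G → ℕ → Set
MinDegree≥ G H k = ∀ v → k ≤ deg G H v

IsFactor : (G : Graph) → SpanningSubgraph G → Set
IsFactor G H = MinDegree≥ G H 1

Odd Even : ℕ → Set
Even k = 2 ∣ k
Odd k = ¬ (2 ∣ k)

IsParityFactor : (G : Graph) → Subset (nV G) → SpanningSubgraph G → Set
IsParityFactor G X H =
  IsFactor G H ×
  (∀ v → v ∈ X → Odd (deg G H v)) ×
  (∀ v → v ∉ X → Even (deg G H v))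

StrongParityProperty : Graph → Set
StrongParityProperty G =
  (X : Subset (nV G)) → Even ∣ X ∣ → ∃ (λ H → IsParityFactor G X H)

module Submission where

-- Proof idea: a T-join argument over the two-element field GF(2) = (Bool, xor, ∧).
-- An edge set S is its indicator E(G) → Bool.  The parity of deg_S(v) is the
-- GF(2)-linear boundary ∂S(v) = ⨁ₑ S(e)·inc(e,v), where inc(e,v) is the parity of
-- the number of ends of e at v, and the handshake lemma says ⨁ᵥ ∂S(v) = 0.  The edges
-- of a walk from u to v, counted mod 2, have boundary {u} ⊕ {v}; summing the walks
-- from a fixed root inside a connected spanning subgraph F yields the T-join lemma:
-- every Y with ⨁ Y = 0 is the boundary of some J ⊆ E(F).
-- For the theorem let N = E(G) ∖ E(F); it meets every vertex since deg_F < deg_G.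
-- For X of even size, Y = X ⊕ ∂N has ⨁ Y = 0; with a T-join J ⊆ E(F) of Y put
-- H = N ⊕ J.

open import Defs
open import Algebra.Bundles using (CommutativeRing)
open import Data.Bool using (Bool; true; false; not; _∧_; _xor_; if_then_else_)
open import Data.Bool.Properties
  using ( xor-∧-commutativeRing; not-involutive; not-distribˡ-xor; xor-assoc
        ; xor-comm; xor-same; xor-identityʳ; ∧-comm; ∧-assoc; ∧-zeroʳ; ∧-identityʳ
        ; ∧-distribˡ-xor; ∧-distribʳ-xor )
open import Data.Empty using (⊥; ⊥-elim)
open import Data.Fin using (Fin; zero; suc; _≟_)
open import Data.Fin.Properties using (¬Fin0)
open import Data.Fin.Subset using (Subset; _∈_; _∉_; ∣_∣)
open import Data.Nat using (ℕ; zero; suc; _+_; _≤_; _<_; z≤n)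
open import Data.Nat.Divisibility using (∣-refl; ∣1⇒≡1; ∣m∣n⇒∣m+n; ∣m+n∣m⇒∣n; _∣0)
open import Data.Nat.Properties
  using (+-*-semiring; ≤-refl; ≤-trans; +-mono-≤; +-identityʳ; +-cancelˡ-<)
open import Data.Product using (_×_; _,_; proj₁; proj₂; ∃)
open import Data.Sum using (_⊎_; inj₁; inj₂)
open import Data.Vec using ([]; _∷_; lookup)
open import Data.Vec.Properties using (lookup⇒[]=; []=⇒lookup)
open import Function using (_∘_)
open import Relation.Nullary using (does; yes; no; contradiction)
open import Relation.Binary.PropositionalEquality
  using (_≡_; refl; sym; trans; cong; cong₂; subst₂; module ≡-Reasoning)

open CommutativeRing xor-∧-commutativeRing using (semiring)
open import Algebra.Properties.Semiring.Sum semiring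
  using (∑-distrib-+; ∑-comm; *-distribˡ-sum; *-distribʳ-sum; sum-cong-≗; sum-replicate-zero)
  renaming (sum to ⨁)
import Algebra.Properties.Semiring.Sum +-*-semiring as ℕ-Sum

open ≡-Reasoning

par : ℕ → Bool
par zero    = false
par (suc n) = not (par n)

par-+ : ∀ m n → par (m + n) ≡ par m xor par n
par-+ zero    n = refl
par-+ (suc m) n = begin
  not (par (m + n))      ≡⟨ cong not (par-+ m n) ⟩
  not (par m xor par n)  ≡⟨ not-distribˡ-xor (par m) (par n) ⟩
  not (par m) xor par n  ∎

par-false⇒even : ∀ n → par n ≡ false → Even n
par-false⇒even zero          _ = 2 ∣0
par-false⇒even (suc zero)    ()
par-false⇒even (suc (suc n)) p =
  ∣m∣n⇒∣m+n ∣-refl (par-false⇒even n (trans (sym (not-involutive (par n))) p))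

par-true⇒odd : ∀ n → par n ≡ true → Odd n
par-true⇒odd zero          ()
par-true⇒odd (suc zero)    _ 2∣1     = contradiction (∣1⇒≡1 2∣1) λ ()
par-true⇒odd (suc (suc n)) p 2∣2+n =
  par-true⇒odd n (trans (sym (not-involutive (par n))) p) (∣m+n∣m⇒∣n 2∣2+n ∣-refl)

even⇒par-false : ∀ n → Even n → par n ≡ false
even⇒par-false n 2∣n with par n in eq
... | false = refl
... | true  = contradiction 2∣n (par-true⇒odd n eq)

par-if : ∀ b n → par (if b then n else 0) ≡ b ∧ par n
par-if false n = refl
par-if true  n = refl

par-sumFin : ∀ {m} (f : Fin m → ℕ) → par (sumFin f) ≡ ⨁ (par ∘ f)
par-sumFin {zero}  f = refl
par-sumFin {suc m} f =
  trans (par-+ (f zero) _) (cong (par (f zero) xor_) (par-sumFin (f ∘ suc)))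

par-∣∣ : ∀ {n} (X : Subset n) → par ∣ X ∣ ≡ ⨁ (lookup X)
par-∣∣ []          = refl
par-∣∣ (false ∷ X) = par-∣∣ X
par-∣∣ (true  ∷ X) = cong not (par-∣∣ X)

⨁-zero : ∀ {m} {f : Fin m → Bool} → (∀ i → f i ≡ false) → ⨁ f ≡ false
⨁-zero {m} f≡0 = trans (sum-cong-≗ f≡0) (sum-replicate-zero m)

⨁-sift : ∀ {m} (g : Fin m → Bool) (x : Fin m) → ⨁ (λ v → does (v ≟ x) ∧ g v) ≡ g x
⨁-sift {suc m} g zero    = trans (cong (g zero xor_) rest≡0) (xor-identityʳ (g zero))
  where
  rest≡0 : ⨁ (λ (v : Fin m) → does (suc v ≟ zero) ∧ g (suc v)) ≡ false
  rest≡0 = ⨁-zero {f = λ v → does (suc v ≟ zero) ∧ g (suc v)} λ _ → refl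
⨁-sift {suc m} g (suc x) = ⨁-sift (g ∘ suc) x

≟-sym : ∀ {m} (a b : Fin m) → does (a ≟ b) ≡ does (b ≟ a)
≟-sym a b with a ≟ b | b ≟ a
... | yes _   | yes _   = refl
... | no  _   | no  _   = refl
... | yes a≡b | no  b≢a = contradiction (sym a≡b) b≢a
... | no  a≢b | yes b≡a = contradiction (sym b≡a) a≢b

⨁-δ : ∀ {m} (a : Fin m) → ⨁ (λ v → does (a ≟ v)) ≡ true
⨁-δ a = begin
  ⨁ (λ v → does (a ≟ v))
    ≡⟨ sum-cong-≗ (λ v → trans (≟-sym a v) (sym (∧-identityʳ _))) ⟩
  ⨁ (λ v → does (v ≟ a) ∧ true)   ≡⟨ ⨁-sift (λ _ → true) a ⟩
  true                            ∎

xor-cancel-middle : ∀ a b c → (a xor b) xor (b xor c) ≡ a xor c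
xor-cancel-middle a b c = begin
  (a xor b) xor (b xor c)  ≡⟨ xor-assoc a b (b xor c) ⟩
  a xor (b xor (b xor c))  ≡⟨ cong (a xor_) (sym (xor-assoc b b c)) ⟩
  a xor ((b xor b) xor c)  ≡⟨ cong (λ t → a xor (t xor c)) (xor-same b) ⟩
  a xor c                  ∎

emptyOrPointed : ∀ n → (Fin n → ⊥) ⊎ Fin n
emptyOrPointed zero    = inj₁ ¬Fin0
emptyOrPointed (suc n) = inj₂ zero

sumFin-mono : ∀ {m} {f g : Fin m → ℕ} → (∀ i → f i ≤ g i) → sumFin f ≤ sumFin g
sumFin-mono {zero}  f≤g = z≤n
sumFin-mono {suc m} f≤g = +-mono-≤ (f≤g zero) (sumFin-mono (f≤g ∘ suc))

sumFin≡sum : ∀ {m} (f : Fin m → ℕ) → sumFin f ≡ ℕ-Sum.sum f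
sumFin≡sum {zero}  f = refl
sumFin≡sum {suc m} f = cong (f zero +_) (sumFin≡sum (f ∘ suc))

sumFin-split : ∀ {m} {f g h : Fin m → ℕ} → (∀ i → h i ≡ f i + g i) →
               sumFin h ≡ sumFin f + sumFin g
sumFin-split {f = f} {g} {h} h≡f+g = begin
  sumFin h                     ≡⟨ sumFin≡sum h ⟩
  ℕ-Sum.sum h                  ≡⟨ ℕ-Sum.sum-cong-≗ h≡f+g ⟩
  ℕ-Sum.sum (λ i → f i + g i)  ≡⟨ ℕ-Sum.∑-distrib-+ f g ⟩
  ℕ-Sum.sum f + ℕ-Sum.sum g    ≡⟨ sym (cong₂ _+_ (sumFin≡sum f) (sumFin≡sum g)) ⟩
  sumFin f + sumFin g          ∎

module EdgeSets (G : Graph) where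

  EdgeSet : Set
  EdgeSet = SpanningSubgraph G

  ∅ : EdgeSet
  ∅ _ = false

  -- S ⊆ T, stated in the form in which it is preserved by GF(2)-sums.
  _⊆_ : EdgeSet → EdgeSet → Set
  S ⊆ T = ∀ e → T e ≡ false → S e ≡ false

  deg-mono : ∀ {S T} → S ⊆ T → ∀ v → deg G S v ≤ deg G T v
  deg-mono {S} {T} S⊆T v = sumFin-mono term≤
    where
    term≤ : ∀ e → (if S e then incidence G e v else 0) ≤ (if T e then incidence G e v else 0)
    term≤ e with T e in Te | S e in Se
    ... | true  | true  = ≤-refl
    ... | true  | false = z≤n
    ... | false | false = z≤n
    ... | false | true  = contradiction (trans (sym Se) (S⊆T e Te)) λ ()

  deg-complement : ∀ F v → degG G v ≡ deg G F v + deg G (not ∘ F) v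
  deg-complement F v = sumFin-split split
    where
    split : ∀ e → incidence G e v ≡
                  (if F e then incidence G e v else 0) + (if not (F e) then incidence G e v else 0)
    split e with F e
    ... | true  = sym (+-identityʳ _)
    ... | false = refl

  complement-meets : ∀ F v → deg G F v < degG G v → 1 ≤ deg G (not ∘ F) v
  complement-meets F v deg-F<deg-G = +-cancelˡ-< (deg G F v) 0 _
    (subst₂ _<_ (sym (+-identityʳ _)) (deg-complement F v) deg-F<deg-G)

  ⟦_⟧ : Fin (nE G) → EdgeSet
  ⟦ e ⟧ e′ = does (e′ ≟ e)

  -- inc e v : parity of the number of ends of e at v (a loop at v gives 0).
  inc : Fin (nE G) → Fin (nV G) → Bool
  inc e v = does (proj₁ (ends G e) ≟ v) xor does (proj₂ (ends G e) ≟ v)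

  ∂ : EdgeSet → Fin (nV G) → Bool
  ∂ S v = ⨁ (λ e → S e ∧ inc e v)

  par-incidence : ∀ e v → par (incidence G e v) ≡ inc e v
  par-incidence e v =
    trans (par-+ (endAt a) (endAt b)) (cong₂ _xor_ (par-endAt a) (par-endAt b))
    where
    a b : Fin (nV G)
    a = proj₁ (ends G e)
    b = proj₂ (ends G e)
    endAt : Fin (nV G) → ℕ
    endAt x = if does (x ≟ v) then 1 else 0
    par-endAt : ∀ x → par (endAt x) ≡ does (x ≟ v)
    par-endAt x = trans (par-if (does (x ≟ v)) 1) (∧-identityʳ _)

  par-deg : ∀ S v → par (deg G S v) ≡ ∂ S v
  par-deg S v = trans (par-sumFin (λ e → if S e then incidence G e v else 0))
    (sum-cong-≗ λ e → trans (par-if (S e) (incidence G e v)) (cong (S e ∧_) (par-incidence e v)))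

  ∂-∅ : ∀ v → ∂ ∅ v ≡ false
  ∂-∅ v = ⨁-zero {f = λ e → ∅ e ∧ inc e v} λ _ → refl

  ∂-⟦⟧ : ∀ e v → ∂ ⟦ e ⟧ v ≡ inc e v
  ∂-⟦⟧ e v = ⨁-sift (λ e′ → inc e′ v) e

  ∂-xor : ∀ S T v → ∂ (λ e → S e xor T e) v ≡ ∂ S v xor ∂ T v
  ∂-xor S T v = trans (sum-cong-≗ λ e → ∧-distribʳ-xor (inc e v) (S e) (T e))
                      (∑-distrib-+ (λ e → S e ∧ inc e v) (λ e → T e ∧ inc e v))

  ∂-scale : ∀ b S v → ∂ (λ e → b ∧ S e) v ≡ b ∧ ∂ S v
  ∂-scale b S v = trans (sum-cong-≗ λ e → ∧-assoc b (S e) (inc e v))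
                        (sym (*-distribˡ-sum b (λ e → S e ∧ inc e v)))

  ∂-⨁ : ∀ {k} (f : Fin k → EdgeSet) v →
        ∂ (λ e → ⨁ (λ i → f i e)) v ≡ ⨁ (λ i → ∂ (f i) v)
  ∂-⨁ f v = trans (sum-cong-≗ λ e → *-distribʳ-sum (inc e v) (λ i → f i e))
                  (∑-comm (λ e i → f i e ∧ inc e v))

  -- Every edge has two ends, so its incidence vector sums to zero.
  ⨁-inc : ∀ e → ⨁ (inc e) ≡ false
  ⨁-inc e = trans (∑-distrib-+ (λ v → does (a ≟ v)) (λ v → does (b ≟ v)))
                  (cong₂ _xor_ (⨁-δ a) (⨁-δ b))
    where
    a b : Fin (nV G)
    a = proj₁ (ends G e)
    b = proj₂ (ends G e)

  handshake : ∀ S → ⨁ (∂ S) ≡ false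
  handshake S = begin
    ⨁ (λ v → ⨁ (λ e → S e ∧ inc e v))  ≡⟨ ∑-comm (λ v e → S e ∧ inc e v) ⟩
    ⨁ (λ e → ⨁ (λ v → S e ∧ inc e v))
      ≡⟨ sum-cong-≗ (λ e → sym (*-distribˡ-sum (S e) (inc e))) ⟩
    ⨁ (λ e → S e ∧ ⨁ (inc e))
      ≡⟨ ⨁-zero (λ e → trans (cong (S e ∧_) (⨁-inc e)) (∧-zeroʳ (S e))) ⟩
    false                              ∎

  walkEdges : ∀ {F u v} → Walk G F u v → EdgeSet
  walkEdges here             = ∅
  walkEdges (step e _ _ w) e′ = ⟦ e ⟧ e′ xor walkEdges w e′

  walkEdges⊆ : ∀ {F u v} (w : Walk G F u v) → walkEdges w ⊆ F
  walkEdges⊆ here             e _    = refl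
  walkEdges⊆ (step e₀ Fe₀ _ w) e Fe≡0 with e ≟ e₀
  ... | yes refl = contradiction (trans (sym Fe₀) Fe≡0) λ ()
  ... | no  _    = walkEdges⊆ w e Fe≡0

  inc-ends : ∀ {e u m} → (ends G e ≡ (u , m) ⊎ ends G e ≡ (m , u)) →
             ∀ x → inc e x ≡ does (u ≟ x) xor does (m ≟ x)
  inc-ends (inj₁ eq) x rewrite eq = refl
  inc-ends {u = u} {m} (inj₂ eq) x rewrite eq = xor-comm (does (m ≟ x)) (does (u ≟ x))

  ∂-walkEdges : ∀ {F u v} (w : Walk G F u v) x →
                ∂ (walkEdges w) x ≡ does (u ≟ x) xor does (v ≟ x)
  ∂-walkEdges {u = u} here x = trans (∂-∅ x) (sym (xor-same (does (u ≟ x))))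
  ∂-walkEdges {u = u} {v} (step {w = m} e _ e-joins w) x = begin
    ∂ (λ e′ → ⟦ e ⟧ e′ xor walkEdges w e′) x  ≡⟨ ∂-xor ⟦ e ⟧ (walkEdges w) x ⟩
    ∂ ⟦ e ⟧ x xor ∂ (walkEdges w) x
      ≡⟨ cong₂ _xor_ (trans (∂-⟦⟧ e x) (inc-ends e-joins x)) (∂-walkEdges w x) ⟩
    (does (u ≟ x) xor does (m ≟ x)) xor (does (m ≟ x) xor does (v ≟ x))
      ≡⟨ xor-cancel-middle (does (u ≟ x)) _ _ ⟩
    does (u ≟ x) xor does (v ≟ x)             ∎

  tJoin : ∀ F → Connected G F → (Y : Fin (nV G) → Bool) → ⨁ Y ≡ false →
          ∃ λ J → J ⊆ F × (∀ x → ∂ J x ≡ Y x)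
  tJoin F F-connected Y ⨁Y≡0 with emptyOrPointed (nV G)
  ... | inj₁ noVertex = ∅ , (λ _ _ → refl) , λ x → ⊥-elim (noVertex x)
  ... | inj₂ r        = J , J⊆F , ∂J≡Y
    where
    W : Fin (nV G) → EdgeSet
    W v = walkEdges (F-connected r v)

    J : EdgeSet
    J e = ⨁ (λ v → Y v ∧ W v e)

    J⊆F : J ⊆ F
    J⊆F e Fe≡0 = ⨁-zero λ v →
      trans (cong (Y v ∧_) (walkEdges⊆ (F-connected r v) e Fe≡0)) (∧-zeroʳ (Y v))

    ∂J≡Y : ∀ x → ∂ J x ≡ Y x
    ∂J≡Y x = begin
      ∂ J x
        ≡⟨ ∂-⨁ (λ v e → Y v ∧ W v e) x ⟩
      ⨁ (λ v → ∂ (λ e → Y v ∧ W v e) x)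
        ≡⟨ sum-cong-≗ (λ v → ∂-scale (Y v) (W v) x) ⟩
      ⨁ (λ v → Y v ∧ ∂ (W v) x)
        ≡⟨ sum-cong-≗ (λ v → cong (Y v ∧_) (∂-walkEdges (F-connected r v) x)) ⟩
      ⨁ (λ v → Y v ∧ (does (r ≟ x) xor does (v ≟ x)))
        ≡⟨ sum-cong-≗ (λ v → ∧-distribˡ-xor (Y v) _ _) ⟩
      ⨁ (λ v → (Y v ∧ does (r ≟ x)) xor (Y v ∧ does (v ≟ x)))
        ≡⟨ ∑-distrib-+ (λ v → Y v ∧ does (r ≟ x)) (λ v → Y v ∧ does (v ≟ x)) ⟩
      ⨁ (λ v → Y v ∧ does (r ≟ x)) xor ⨁ (λ v → Y v ∧ does (v ≟ x))
        ≡⟨ cong₂ _xor_ rootTerm (trans (sum-cong-≗ λ v → ∧-comm (Y v) _) (⨁-sift Y x)) ⟩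
      Y x ∎
      where
      rootTerm : ⨁ (λ v → Y v ∧ does (r ≟ x)) ≡ false
      rootTerm = trans (sym (*-distribʳ-sum (does (r ≟ x)) Y)) (cong (_∧ does (r ≟ x)) ⨁Y≡0)

  parityFactor : ∀ X H → IsFactor G H → (∀ v → ∂ H v ≡ lookup X v) → IsParityFactor G X H
  parityFactor X H H-factor ∂H≡X = H-factor , odd , even
    where
    odd : ∀ v → v ∈ X → Odd (deg G H v)
    odd v v∈X = par-true⇒odd _ (trans (par-deg H v) (trans (∂H≡X v) ([]=⇒lookup v∈X)))

    even : ∀ v → v ∉ X → Even (deg G H v)
    even v v∉X = par-false⇒even _ (trans (par-deg H v) (trans (∂H≡X v) v-outside))
      where
      v-outside : lookup X v ≡ false
      v-outside with lookup X v in eq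
      ... | false = refl
      ... | true  = contradiction (lookup⇒[]= v X eq) v∉X

  -- For an even X the
  -- witness is H = N ⊕ J, where J ⊆ F is a T-join of X ⊕ ∂N.
  strongParity : ∀ F → Connected G F → IsFactor G (not ∘ F) → StrongParityProperty G
  strongParity F F-connected N-factor X even∣X∣ = H , parityFactor X H H-factor ∂H≡X
    where
    N : EdgeSet
    N = not ∘ F

    Y : Fin (nV G) → Bool
    Y v = lookup X v xor ∂ N v

    ⨁Y≡0 : ⨁ Y ≡ false
    ⨁Y≡0 = trans (∑-distrib-+ (lookup X) (∂ N))
      (cong₂ _xor_ (trans (sym (par-∣∣ X)) (even⇒par-false _ even∣X∣)) (handshake N))

    join : ∃ λ J → J ⊆ F × (∀ x → ∂ J x ≡ Y x)
    join = tJoin F F-connected Y ⨁Y≡0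

    J : EdgeSet
    J = proj₁ join

    H : EdgeSet
    H e = N e xor J e

    N⊆H : N ⊆ H
    N⊆H e He≡0 with F e in Fe
    ... | true  = refl
    ... | false rewrite proj₁ (proj₂ join) e Fe = contradiction He≡0 λ ()

    H-factor : IsFactor G H
    H-factor v = ≤-trans (N-factor v) (deg-mono N⊆H v)

    ∂H≡X : ∀ v → ∂ H v ≡ lookup X v
    ∂H≡X v = begin
      ∂ H v                             ≡⟨ ∂-xor N J v ⟩
      ∂ N v xor ∂ J v                   ≡⟨ cong (∂ N v xor_) (proj₂ (proj₂ join) v) ⟩
      ∂ N v xor (lookup X v xor ∂ N v)  ≡⟨ cong (∂ N v xor_) (xor-comm (lookup X v) _) ⟩
      ∂ N v xor (∂ N v xor lookup X v)  ≡⟨ xor-cancel-middle false (∂ N v) (lookup X v) ⟩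
      lookup X v                        ∎

mainTheorem3 : (G : Graph) → ConnectedGraph G → MinDegree≥ G (allEdges G) 2 →
    (F : SpanningSubgraph G) → IsFactor G F → Connected G F →
    (∀ v → deg G F v < degG G v) →
    StrongParityProperty G
mainTheorem3 G _ _ F _ F-connected deg-F<deg-G =
  strongParity F F-connected (λ v → complement-meets F v (deg-F<deg-G v))
  where open EdgeSets G
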